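{- Let $k\ge 1$ be an integer, let $t = 2^{k+2}-2$, and let $G$ be a finite $k$-edge stable graph. Let $\epsilon$ be a real number with $0<\epsilon < \frac{1}{2^t}$. Then for every set of vertices $A \subseteq G$ with $|A| \geq \frac{1}{\epsilon^t}$ there exists an $\epsilon$-excellent subset $A' \subseteq A$ with $|A'| \geq \epsilon^{t-1}|A|$.
   Context: A graph is a finite set of vertices with a symmetric irreflexive edge relation $R$; a subset $A\subseteq G$ of vertices is regarded as the induced subgraph, and $|A|$ is its number of vertices. For a formula $\varphi$ write $\varphi^1=\varphi$ and $\varphi^0=\neg\varphi$. A graph $G$ is $k$-edge stable if there do not exist distinct vertices $a_1,\dots,a_k,b_1,\dots,b_k$ of $G$ such that $R(a_i,b_j)$ holds iff $i<j$. (The number $t=2^{k+2}-2$ is the "tree bound": by a known fact, a $k$-edge stable graph contains no full special tree of height $t$, where a full special tree of height $n$ consists of vertices $\langle b_\rho:\rho\in 2^{<n}\rangle$ and $\langle a_\eta:\eta\in 2^n\rangle$ such that whenever $\rho^\frown\langle \ell\rangle$ is an initial segment of $\eta$, $R(a_\eta,b_\rho)^\ell$ holds.) A set $A\subseteq G$ is $\epsilon$-good if for every vertex $b\in G$, either $|\{a\in A: R(b,a)\}|<\epsilon|A|$ or $|\{a\in A:\neg R(b,a)\}|<\epsilon|A|$; in that case $\mathbf{t}(b,A)\in\{0,1\}$ denotes a truth value such that for all but fewer than $\epsilon|A|$ elements $a\in A$, $R(b,a)^{\mathbf{t}(b,A)}$ holds. A set $A\subseteq G$ is $\epsilon$-excellent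 if for every $\epsilon$-good $B\subseteq G$, either $|\{a\in A:\mathbf{t}(a,B)=1\}|<\epsilon|A|$ or $|\{a\in A:\mathbf{t}(a,B)=0\}|<\epsilon|A|$.
   Formalization: The parameter ε ranges over the rationals instead of the reals. -}

module Defs where

open import Data.Nat using (ℕ; zero; suc; _+_; _∸_; _^_)
open import Data.Bool using (Bool; true; false; not)
open import Data.Fin using (Fin; _<_)
open import Data.Fin.Subset using (Subset; _∩_; ∣_∣; _⊆_)
open import Data.Vec using (tabulate)
open import Data.Sum using (_⊎_)
open import Data.Product using (Σ; _×_; _,_)
open import Data.Integer using (+_)
open import Data.Rational using (ℚ; 1ℚ; _*_)
import Data.Rational as Q
open import Data.Rational.Properties using (_<?_)
open import Relation.Nullary using (¬_; does)
open import Relation.Binary.PropositionalEquality using (_≡_; _≢_)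
open import Function using (_⇔_)

record Graph (n : ℕ) : Set where
  field
    E      : Fin n → Fin n → Bool
    symm   : ∀ a b → E a b ≡ E b a
    irrefl : ∀ a → E a a ≡ false
open Graph public

ℕ→ℚ : ℕ → ℚ
ℕ→ℚ m = + m Q./ 1

_^ℚ_ : ℚ → ℕ → ℚ
q ^ℚ zero  = 1ℚ
q ^ℚ suc m = q * (q ^ℚ m)

EdgeStable : ∀ {n} → ℕ → Graph n → Set
EdgeStable {n} k G =
  ¬ (Σ (Fin k → Fin n) λ a → Σ (Fin k → Fin n) λ b →
       (∀ i j → a i ≡ a j → i ≡ j) ×
       (∀ i j → b i ≡ b j → i ≡ j) ×
       (∀ i j → a i ≢ b j) ×
       (∀ i j → (E G (a i) (b j) ≡ true) ⇔ (i < j)))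

nbrs : ∀ {n} → Graph n → Fin n → Subset n → Subset n
nbrs G b A = A ∩ tabulate (E G b)

nonNbrs : ∀ {n} → Graph n → Fin n → Subset n → Subset n
nonNbrs G b A = A ∩ tabulate (λ a → not (E G b a))

Small : ∀ {n} → ℚ → Subset n → Subset n → Set
Small ε X A = ℕ→ℚ ∣ X ∣ Q.< ε * ℕ→ℚ ∣ A ∣

Good : ∀ {n} → Graph n → ℚ → Subset n → Set
Good {n} G ε A = ∀ (b : Fin n) → Small ε (nbrs G b A) A ⊎ Small ε (nonNbrs G b A) A

-- t(b,A): true iff fewer than ε|A| elements of A are non-neighbours of b.
-- (For an ε-good A with ε ≤ 1/2 this is the unique value such that
--  R(b,a)^t(b,A) holds for all but fewer than ε|A| elements a ∈ A.)
tv : ∀ {n} → Graph n → ℚ → Fin n → Subset n → Bool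
tv G ε b A = does (ℕ→ℚ ∣ nonNbrs G b A ∣ <? ε * ℕ→ℚ ∣ A ∣)

withT : ∀ {n} → Graph n → ℚ → Subset n → Bool → Subset n → Subset n
withT G ε B true  A = A ∩ tabulate (λ a → tv G ε a B)
withT G ε B false A = A ∩ tabulate (λ a → not (tv G ε a B))

Excellent : ∀ {n} → Graph n → ℚ → Subset n → Set
Excellent {n} G ε A = ∀ (B : Subset n) → Good G ε B →
  Small ε (withT G ε B true A) A ⊎ Small ε (withT G ε B false A) A

treeBound : ℕ → ℕ
treeBound k = 2 ^ (k + 2) ∸ 2

{-# OPTIONS --safe #-}

-- Either A is ε-excellent, or some ε-good B splits it into A₁ = {a ∈ A : t(a,B) = 1}
-- and A₀ = {a ∈ A : t(a,B) = 0}, both of size at least ε|A|.  Recursing into both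
-- halves for t - 1 rounds, either some set reached is excellent, and it has at
-- least ε^(t-1)|A| elements, or every branch survives and the recursion builds a
-- full special tree of height t - 1: the trees found inside A₁ and A₀ are joined
-- under a vertex b ∈ B adjacent to all leaves in A₁ and to no leaf in A₀.  Such a b
-- exists because each leaf excludes fewer than ε|B| vertices of B and there are
-- 2^(t-1) leaves, while 2^(t-1)ε ≤ 1.  Finally a special tree of height 2^(k+2) - 4
-- contains a half graph of size k, which k-edge stability forbids.
module Submission where

open import Defs
open import Data.Nat using (ℕ; _∸_)
open import Data.Fin.Subset using (Subset; _⊆_; ∣_∣)
open import Data.Rational using (ℚ; 0ℚ; 1ℚ; _<_; _≤_; _*_; ½)
open import Data.Product using (Σ; _×_)

open import Data.Bool using (Bool; true; false; not; if_then_else_)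
open import Data.Bool.Properties using (not-¬; ¬-not; not-injective; T-≡)
open import Data.Empty using (⊥-elim)
open import Data.Fin using (Fin; zero; suc; toℕ)
import Data.Fin.Properties as Finₚ
open import Data.Fin.Subset using (_∈_; _∉_; _∩_; _∪_; ⋃; ⊥; inside; outside)
open import Data.Fin.Subset.Properties
  using (x∈p∩q⁺; x∈p∩q⁻; p⊆p∪q; q⊆p∪q; ∣⊥∣≡0; ∣p∣≤∣x∷p∣; anySubset?)
open import Data.Integer as ℤ using (+_)
import Data.Integer.Properties as ℤₚ
open import Data.List using (List; []; _∷_; _++_; length; map)
open import Data.List.Properties using (length-++; length-map)
open import Data.List.Relation.Unary.All as All using (All; []; _∷_)
import Data.List.Relation.Unary.All.Properties as All
import Data.Nat as ℕ
open import Data.Nat using (zero; suc; _+_; _^_; _<ᵇ_; z≤n; s≤s)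
import Data.Nat.Coprimality as Coprime
import Data.Nat.Properties as ℕₚ
open import Data.Nat.Tactic.RingSolver using (solve-∀)
open import Data.Product using (∃; _,_; proj₁; proj₂)
import Data.Product as Product
import Data.Rational as ℚ
open import Data.Rational using (mkℚ; _/_; *≤*; nonNegative)
open import Data.Rational.Properties
open import Data.Rational.Solver using (module +-*-Solver)
open import Data.Sum using (_⊎_; inj₁; inj₂; [_,_]′)
import Data.Sum as Sum
open import Data.Vec using ([]; _∷_; tabulate; here; there)
open import Data.Vec.Properties using (lookup∘tabulate; []=⇒lookup; lookup⇒[]=)
open import Function using (id; _∘_; mk⇔; Equivalence)
open import Relation.Binary using (tri<; tri≈; tri>)
open import Relation.Binary.PropositionalEquality
  using (_≡_; _≢_; refl; sym; trans; cong; cong₂; subst; module ≡-Reasoning)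
open import Relation.Nullary using (¬_; Dec; yes; no; does; proof; ¬?)
open import Relation.Nullary.Decidable using (_×-dec_; _⊎-dec_; from-yes)
open import Relation.Nullary.Reflects using (invert)
open import Relation.Unary using (U)

ℕ→ℚ≡mkℚ : ∀ m → ℕ→ℚ m ≡ mkℚ (+ m) 0 (Coprime.sym (Coprime.1-coprimeTo m))
ℕ→ℚ≡mkℚ m = normalize-coprime (Coprime.sym (Coprime.1-coprimeTo m))

ℕ→ℚ-homo-+ : ∀ m n → ℕ→ℚ (m + n) ≡ ℕ→ℚ m ℚ.+ ℕ→ℚ n
ℕ→ℚ-homo-+ m n rewrite ℕ→ℚ≡mkℚ m | ℕ→ℚ≡mkℚ n =
  cong (_/ 1) (sym (cong₂ ℤ._+_ (ℤₚ.*-identityʳ (+ m)) (ℤₚ.*-identityʳ (+ n))))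

ℕ→ℚ-mono-≤ : ∀ {m n} → m ℕ.≤ n → ℕ→ℚ m ≤ ℕ→ℚ n
ℕ→ℚ-mono-≤ {m} {n} m≤n rewrite ℕ→ℚ≡mkℚ m | ℕ→ℚ≡mkℚ n =
  *≤* (ℤₚ.*-monoʳ-≤-nonNeg (+ 1) (ℤ.+≤+ m≤n))

ℕ→ℚ-cancel-< : ∀ {m n} → ℕ→ℚ m < ℕ→ℚ n → m ℕ.< n
ℕ→ℚ-cancel-< lt = ℕₚ.≰⇒> (λ n≤m → <-irrefl refl (<-≤-trans lt (ℕ→ℚ-mono-≤ n≤m)))

ℕ→ℚ-nonNeg : ∀ m → 0ℚ ≤ ℕ→ℚ m
ℕ→ℚ-nonNeg m = ℕ→ℚ-mono-≤ {0} {m} z≤n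

ℕ→ℚ-suc-* : ∀ m p → ℕ→ℚ (suc m) * p ≡ p ℚ.+ ℕ→ℚ m * p
ℕ→ℚ-suc-* m p = begin
  ℕ→ℚ (1 + m) * p          ≡⟨ cong (_* p) (ℕ→ℚ-homo-+ 1 m) ⟩
  (1ℚ ℚ.+ ℕ→ℚ m) * p       ≡⟨ *-distribʳ-+ p 1ℚ (ℕ→ℚ m) ⟩
  1ℚ * p ℚ.+ ℕ→ℚ m * p     ≡⟨ cong (ℚ._+ ℕ→ℚ m * p) (*-identityˡ p) ⟩
  p ℚ.+ ℕ→ℚ m * p          ∎
  where open ≡-Reasoning

^ℚ-nonNeg : ∀ {x} → 0ℚ ≤ x → ∀ m → 0ℚ ≤ x ^ℚ m
^ℚ-nonNeg 0≤x zero    = from-yes (0ℚ ≤? 1ℚ)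
^ℚ-nonNeg {x} 0≤x (suc m) = nonNegative⁻¹ _
  {{nonNeg*nonNeg⇒nonNeg x {{nonNegative 0≤x}} (x ^ℚ m) {{nonNegative (^ℚ-nonNeg 0≤x m)}}}}

^ℚ-antitone : ∀ {x} → 0ℚ ≤ x → x ≤ 1ℚ → ∀ {m m′} → m ℕ.≤ m′ → x ^ℚ m′ ≤ x ^ℚ m
^ℚ-antitone         0≤x x≤1 {zero}  {zero}   _         = ≤-refl
^ℚ-antitone {x}     0≤x x≤1 {zero}  {suc m′} _         = begin
  x * x ^ℚ m′   ≤⟨ *-monoʳ-≤-nonNeg (x ^ℚ m′) {{nonNegative (^ℚ-nonNeg 0≤x m′)}} x≤1 ⟩
  1ℚ * x ^ℚ m′  ≡⟨ *-identityˡ (x ^ℚ m′) ⟩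
  x ^ℚ m′       ≤⟨ ^ℚ-antitone 0≤x x≤1 {zero} {m′} z≤n ⟩
  1ℚ            ∎
  where open ≤-Reasoning
^ℚ-antitone {x}     0≤x x≤1 {suc m} {suc m′} (s≤s m≤m′) =
  *-monoˡ-≤-nonNeg x {{nonNegative 0≤x}} (^ℚ-antitone 0≤x x≤1 m≤m′)

^ℚ-suc-*-≤ : ∀ {x y z} m → 0ℚ ≤ x → x * y ≤ z → x ^ℚ suc m * y ≤ x ^ℚ m * z
^ℚ-suc-*-≤ {x} {y} {z} m 0≤x xy≤z = begin
  (x * x ^ℚ m) * y  ≡⟨ rearrange x (x ^ℚ m) y ⟩
  x ^ℚ m * (x * y)  ≤⟨ *-monoˡ-≤-nonNeg (x ^ℚ m) {{nonNegative (^ℚ-nonNeg 0≤x m)}} xy≤z ⟩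
  x ^ℚ m * z        ∎
  where
  open ≤-Reasoning
  open +-*-Solver
  rearrange : ∀ x p y → (x * p) * y ≡ p * (x * y)
  rearrange = solve 3 (λ x p y → (x :* p) :* y := p :* (x :* y)) refl

2^m+2^m≡2^[1+m] : ∀ m → 2 ^ m + 2 ^ m ≡ 2 ^ suc m
2^m+2^m≡2^[1+m] m = cong (λ k → 2 ^ m + k) (sym (ℕₚ.+-identityʳ (2 ^ m)))

2^m*½^m≡1 : ∀ m → ℕ→ℚ (2 ^ m) * ½ ^ℚ m ≡ 1ℚ
2^m*½^m≡1 zero    = refl
2^m*½^m≡1 (suc m) = begin
  ℕ→ℚ (2 ^ suc m) * (½ * ½ ^ℚ m)
    ≡⟨ cong (λ k → ℕ→ℚ k * (½ * ½ ^ℚ m)) (sym (2^m+2^m≡2^[1+m] m)) ⟩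
  ℕ→ℚ (2 ^ m + 2 ^ m) * (½ * ½ ^ℚ m)
    ≡⟨ cong (_* (½ * ½ ^ℚ m)) (ℕ→ℚ-homo-+ (2 ^ m) (2 ^ m)) ⟩
  (ℕ→ℚ (2 ^ m) ℚ.+ ℕ→ℚ (2 ^ m)) * (½ * ½ ^ℚ m)
    ≡⟨ double-half (ℕ→ℚ (2 ^ m)) (½ ^ℚ m) ⟩
  ℕ→ℚ (2 ^ m) * ½ ^ℚ m
    ≡⟨ 2^m*½^m≡1 m ⟩
  1ℚ ∎
  where
  open ≡-Reasoning
  open +-*-Solver
  double-half : ∀ a p → (a ℚ.+ a) * (½ * p) ≡ a * p
  double-half = solve 2 (λ a p → (a :+ a) :* (con ½ :* p) := a :* p) refl

2^m*ε≤1 : ∀ m {ε} → 0ℚ ≤ ε → ε ≤ ½ ^ℚ m → ℕ→ℚ (2 ^ m) * ε ≤ 1ℚ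
2^m*ε≤1 m {ε} 0≤ε ε≤½^m = begin
  ℕ→ℚ (2 ^ m) * ε       ≤⟨ *-monoˡ-≤-nonNeg (ℕ→ℚ (2 ^ m)) {{nonNegative (ℕ→ℚ-nonNeg (2 ^ m))}}
                                            ε≤½^m ⟩
  ℕ→ℚ (2 ^ m) * ½ ^ℚ m  ≡⟨ 2^m*½^m≡1 m ⟩
  1ℚ                    ∎
  where open ≤-Reasoning

module _ {n : ℕ} where

  x∈tabulate⁺ : ∀ {f : Fin n → Bool} {x} → f x ≡ true → x ∈ tabulate f
  x∈tabulate⁺ {f} {x} fx≡true = lookup⇒[]= x (tabulate f) (trans (lookup∘tabulate f x) fx≡true)

  x∈tabulate⁻ : ∀ {f : Fin n → Bool} {x} → x ∈ tabulate f → f x ≡ true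
  x∈tabulate⁻ {f} {x} x∈f = trans (sym (lookup∘tabulate f x)) ([]=⇒lookup x∈f)

  x∈p∧x∉p∩tabulate⇒false : ∀ {p} {f : Fin n → Bool} {x} → x ∈ p → x ∉ p ∩ tabulate f → f x ≡ false
  x∈p∧x∉p∩tabulate⇒false x∈p x∉ = ¬-not (λ fx≡true → x∉ (x∈p∩q⁺ (x∈p , x∈tabulate⁺ fx≡true)))

∣p∪q∣≤∣p∣+∣q∣ : ∀ {n} (p q : Subset n) → ∣ p ∪ q ∣ ℕ.≤ ∣ p ∣ + ∣ q ∣
∣p∪q∣≤∣p∣+∣q∣ []            []            = z≤n
∣p∪q∣≤∣p∣+∣q∣ (inside  ∷ p) (inside  ∷ q) =
  s≤s (ℕₚ.≤-trans (∣p∪q∣≤∣p∣+∣q∣ p q) (ℕₚ.+-monoʳ-≤ ∣ p ∣ (ℕₚ.n≤1+n ∣ q ∣)))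
∣p∪q∣≤∣p∣+∣q∣ (inside  ∷ p) (outside ∷ q) = s≤s (∣p∪q∣≤∣p∣+∣q∣ p q)
∣p∪q∣≤∣p∣+∣q∣ (outside ∷ p) (inside  ∷ q) =
  ℕₚ.≤-trans (s≤s (∣p∪q∣≤∣p∣+∣q∣ p q)) (ℕₚ.≤-reflexive (sym (ℕₚ.+-suc ∣ p ∣ ∣ q ∣)))
∣p∪q∣≤∣p∣+∣q∣ (outside ∷ p) (outside ∷ q) = ∣p∪q∣≤∣p∣+∣q∣ p q

there-∖ : ∀ {n s t} {p q : Subset n} → (∃ λ x → x ∈ q × x ∉ p) → ∃ λ x → x ∈ t ∷ q × x ∉ s ∷ p
there-∖ (x , x∈q , x∉p) = suc x , there x∈q , λ { (there x∈p) → x∉p x∈p }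

∣p∣<∣q∣⇒∃x∈q∖p : ∀ {n} (p q : Subset n) → ∣ p ∣ ℕ.< ∣ q ∣ → ∃ λ x → x ∈ q × x ∉ p
∣p∣<∣q∣⇒∃x∈q∖p []            []            ()
∣p∣<∣q∣⇒∃x∈q∖p (s       ∷ p) (outside ∷ q) lt       =
  there-∖ (∣p∣<∣q∣⇒∃x∈q∖p p q (ℕₚ.<-≤-trans (s≤s (∣p∣≤∣x∷p∣ s p)) lt))
∣p∣<∣q∣⇒∃x∈q∖p (outside ∷ p) (inside  ∷ q) _        = zero , here , λ ()
∣p∣<∣q∣⇒∃x∈q∖p (inside  ∷ p) (inside  ∷ q) (s≤s lt) = there-∖ (∣p∣<∣q∣⇒∃x∈q∖p p q lt)

∉⋃⇒All∉ : ∀ {n x} (Ss : List (Subset n)) → x ∉ ⋃ Ss → All (x ∉_) Ss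
∉⋃⇒All∉ []       _     = []
∉⋃⇒All∉ (S ∷ Ss) x∉⋃ = (x∉⋃ ∘ p⊆p∪q (⋃ Ss)) ∷ ∉⋃⇒All∉ Ss (x∉⋃ ∘ q⊆p∪q S (⋃ Ss))

ℕ→ℚ∣p∪q∣≤ : ∀ {n} (p q : Subset n) → ℕ→ℚ ∣ p ∪ q ∣ ≤ ℕ→ℚ ∣ p ∣ ℚ.+ ℕ→ℚ ∣ q ∣
ℕ→ℚ∣p∪q∣≤ p q = ≤-trans (ℕ→ℚ-mono-≤ (∣p∪q∣≤∣p∣+∣q∣ p q)) (≤-reflexive (ℕ→ℚ-homo-+ ∣ p ∣ ∣ q ∣))

ℕ→ℚ∣⋃∣≤ : ∀ {n e} (Ss : List (Subset n)) → All (λ S → ℕ→ℚ ∣ S ∣ ≤ e) Ss →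
       ℕ→ℚ ∣ ⋃ Ss ∣ ≤ ℕ→ℚ (length Ss) * e
ℕ→ℚ∣⋃∣≤ {n} {e} []       []            rewrite ∣⊥∣≡0 n = ≤-reflexive (sym (*-zeroˡ e))
ℕ→ℚ∣⋃∣≤ {e = e} (S ∷ Ss) (S≤e ∷ Ss≤e) = begin
  ℕ→ℚ ∣ S ∪ ⋃ Ss ∣             ≤⟨ ℕ→ℚ∣p∪q∣≤ S (⋃ Ss) ⟩
  ℕ→ℚ ∣ S ∣ ℚ.+ ℕ→ℚ ∣ ⋃ Ss ∣    ≤⟨ +-mono-≤ S≤e (ℕ→ℚ∣⋃∣≤ Ss Ss≤e) ⟩
  e ℚ.+ ℕ→ℚ (length Ss) * e    ≡⟨ sym (ℕ→ℚ-suc-* (length Ss) e) ⟩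
  ℕ→ℚ (suc (length Ss)) * e    ∎
  where open ≤-Reasoning

ℕ→ℚ∣⋃∣< : ∀ {n e} (S : Subset n) Ss → All (λ S → ℕ→ℚ ∣ S ∣ < e) (S ∷ Ss) →
       ℕ→ℚ ∣ ⋃ (S ∷ Ss) ∣ < ℕ→ℚ (length (S ∷ Ss)) * e
ℕ→ℚ∣⋃∣< {e = e} S Ss (S<e ∷ Ss<e) = begin-strict
  ℕ→ℚ ∣ S ∪ ⋃ Ss ∣             ≤⟨ ℕ→ℚ∣p∪q∣≤ S (⋃ Ss) ⟩
  ℕ→ℚ ∣ S ∣ ℚ.+ ℕ→ℚ ∣ ⋃ Ss ∣    <⟨ +-mono-<-≤ S<e (ℕ→ℚ∣⋃∣≤ Ss (All.map <⇒≤ Ss<e)) ⟩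
  e ℚ.+ ℕ→ℚ (length Ss) * e    ≡⟨ sym (ℕ→ℚ-suc-* (length Ss) e) ⟩
  ℕ→ℚ (suc (length Ss)) * e    ∎
  where open ≤-Reasoning

avoid-small-sets : ∀ {n e} (B : Subset n) (Ss : List (Subset n)) → 0 ℕ.< length Ss →
                   All (λ S → ℕ→ℚ ∣ S ∣ < e) Ss → ℕ→ℚ (length Ss) * e ≤ ℕ→ℚ ∣ B ∣ →
                   ∃ λ b → b ∈ B × All (b ∉_) Ss
avoid-small-sets B (S ∷ Ss) _ Ss<e Ss·e≤∣B∣ =
  let b , b∈B , b∉⋃ = ∣p∣<∣q∣⇒∃x∈q∖p (⋃ (S ∷ Ss)) B
                        (ℕ→ℚ-cancel-< (<-≤-trans (ℕ→ℚ∣⋃∣< S Ss Ss<e) Ss·e≤∣B∣))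
  in b , b∈B , ∉⋃⇒All∉ (S ∷ Ss) b∉⋃

-- Special trees

⊎-Π : ∀ {a b} {A : Set a} {B : Bool → Set b} → ((ℓ : Bool) → A ⊎ B ℓ) → A ⊎ ((ℓ : Bool) → B ℓ)
⊎-Π f with f true | f false
... | inj₁ x  | _       = inj₁ x
... | inj₂ _  | inj₁ x  = inj₁ x
... | inj₂ y₁ | inj₂ y₀ = inj₂ λ { true → y₁ ; false → y₀ }

Π-⊎ : ∀ {a b} {A : Bool → Set a} {B : Set b} → ((ℓ : Bool) → A ℓ ⊎ B) → ((ℓ : Bool) → A ℓ) ⊎ B
Π-⊎ f = Sum.swap (⊎-Π (Sum.swap ∘ f))

All-++-select : ∀ {a p} {A : Set a} {P : A → Set p} (xs : Bool → List A) ℓ →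
                All P (xs true ++ xs false) → All P (xs ℓ)
All-++-select xs true  = proj₁ ∘ All.++⁻ (xs true)
All-++-select xs false = proj₂ ∘ All.++⁻ (xs true)

module _ {n : ℕ} (G : Graph n) where

  -- Full special trees, with vertices allowed to repeat: P constrains the internal
  -- vertices, X the leaves, and every leaf x below child ℓ of b satisfies R(x,b)^ℓ.
  data Tree (P : Fin n → Set) : (Fin n → Set) → ℕ → Set₁ where
    leaf : ∀ {X} x → X x → Tree P X 0
    node : ∀ {X m} b → P b → ((ℓ : Bool) → Tree P (λ x → X x × E G x b ≡ ℓ) m) → Tree P X (suc m)

  private variable
    P Q X Y : Fin n → Set
    m m′ : ℕ

  someLeaf : Tree P X m → Σ (Fin n) X
  someLeaf (leaf x x∈X)  = x , x∈X
  someLeaf (node _ _ t) = Product.map₂ proj₁ (someLeaf (t true))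

  Tree-leaf : Tree P X m → Tree Q X 0
  Tree-leaf t = Product.uncurry leaf (someLeaf t)

  Tree-map : (∀ {b} → P b → Q b) → (∀ {x} → X x → Y x) → Tree P X m → Tree Q Y m
  Tree-map f g (leaf x x∈X)    = leaf x (g x∈X)
  Tree-map f g (node b b∈P t) = node b (f b∈P) λ ℓ → Tree-map f (Product.map₁ g) (t ℓ)

  Tree-lower : m ℕ.≤ m′ → Tree P X m′ → Tree P X m
  Tree-lower {m = zero}  _          t               = Tree-leaf t
  Tree-lower {m = suc m} (s≤s m≤m′) (node b b∈P t) = node b b∈P λ ℓ → Tree-lower m≤m′ (t ℓ)

  leaves : Tree P X m → List (Fin n)
  leaves (leaf x _)    = x ∷ []
  leaves (node _ _ t) = leaves (t true) ++ leaves (t false)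

  length-leaves : (t : Tree P X m) → length (leaves t) ≡ 2 ^ m
  length-leaves (leaf _ _)              = refl
  length-leaves {m = suc m} (node _ _ t) = begin
    length (leaves (t true) ++ leaves (t false))
      ≡⟨ length-++ (leaves (t true)) ⟩
    length (leaves (t true)) + length (leaves (t false))
      ≡⟨ cong₂ _+_ (length-leaves (t true)) (length-leaves (t false)) ⟩
    2 ^ m + 2 ^ m
      ≡⟨ 2^m+2^m≡2^[1+m] m ⟩
    2 ^ suc m ∎
    where open ≡-Reasoning

  All-leaves : (t : Tree P X m) → All X (leaves t)
  All-leaves (leaf _ x∈X)  = x∈X ∷ []
  All-leaves (node _ _ t) =
    All.++⁺ (All.map proj₁ (All-leaves (t true))) (All.map proj₁ (All-leaves (t false)))

  Tree-restrict : (t : Tree P X m) → All Q (leaves t) → Tree P (λ x → X x × Q x) m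
  Tree-restrict (leaf x x∈X)    (x∈Q ∷ []) = leaf x (x∈X , x∈Q)
  Tree-restrict (node b b∈P t) Qs         = node b b∈P λ ℓ →
    Tree-map id (λ ((x∈X , side) , x∈Q) → (x∈X , x∈Q) , side)
                (Tree-restrict (t ℓ) (All-++-select (leaves ∘ t) ℓ Qs))

  Tree-avoidLeaf : ∀ v → Tree P X (suc m) → Tree P (λ x → X x × x ≢ v) m
  Tree-avoidLeaf v (node b _ t) =
    Tree-map id (λ (x∈X , xb≡¬vb) → x∈X , λ { refl → not-¬ refl xb≡¬vb }) (t (not (E G v b)))

  Tree-nodes≢ : ∀ {a ℓ} → (∀ {x} → X x → E G x a ≡ ℓ) → Tree P X m → Tree (λ b → P b × b ≢ a) X m
  Tree-nodes≢ _ (leaf x x∈X) = leaf x x∈X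
  Tree-nodes≢ {a = a} {ℓ} side (node b b∈P t) =
    node b (b∈P , b≢a) λ ℓ′ → Tree-nodes≢ (side ∘ proj₁) (t ℓ′)
    where
    b≢a : b ≢ a
    b≢a b≡a = let x , x∈X , xb≡¬ℓ = someLeaf (t (not ℓ))
              in not-¬ (side x∈X) (trans (cong (E G x) (sym b≡a)) xb≡¬ℓ)

  Tree-avoidNode : ∀ a → Tree P X (suc m) → Tree (λ b → P b × b ≢ a) X m
  Tree-avoidNode {m = zero}  a t = Tree-leaf t
  Tree-avoidNode {m = suc m} a (node b b∈P t) with b Finₚ.≟ a
  ... | yes refl = Tree-map id proj₁ (Tree-nodes≢ proj₂ (t true))
  ... | no  b≢a  = node b (b∈P , b≢a) λ ℓ → Tree-avoidNode a (t ℓ)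

  Tree-ramsey : (c : Fin n → Bool) → ∀ p q → Tree P X (p + q) →
                Tree (λ b → P b × c b ≡ true) X p ⊎ Tree (λ b → P b × c b ≡ false) X q
  Tree-ramsey c zero    q       t = inj₁ (Tree-leaf t)
  Tree-ramsey c (suc p) zero    t = inj₂ (Tree-leaf t)
  Tree-ramsey c (suc p) (suc q) (node b b∈P t) with c b in cb
  ... | true  = Sum.map (node b (b∈P , cb)) id
                  (Π-⊎ λ ℓ → Sum.map₂ (Tree-map id proj₁) (Tree-ramsey c p (suc q) (t ℓ)))
  ... | false = Sum.map id (node b (b∈P , cb))
                  (⊎-Π λ ℓ → Sum.map₁ (Tree-map id proj₁)
                                      (Tree-ramsey c (suc p) q (subst (Tree _ _) (ℕₚ.+-suc p q) (t ℓ))))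

-- Half graphs

<ᵇ-true : ∀ {i j} → i ℕ.< j → (i <ᵇ j) ≡ true
<ᵇ-true i<j = Equivalence.to T-≡ (ℕₚ.<⇒<ᵇ i<j)

<ᵇ-false : ∀ {i j} → j ℕ.≤ i → (i <ᵇ j) ≡ false
<ᵇ-false {i} {j} j≤i = ¬-not λ i<ᵇj → ℕₚ.<⇒≱ (ℕₚ.<ᵇ⇒< i j (Equivalence.from T-≡ i<ᵇj)) j≤i

_◂_ : ∀ {A : Set} → A → (ℕ → A) → ℕ → A
(x ◂ f) zero    = x
(x ◂ f) (suc i) = f i

snoc : ∀ {A : Set} → ℕ → (ℕ → A) → A → ℕ → A
snoc k f x i with i ℕ.<? k
... | yes _ = f i
... | no  _ = x

snoc-elim : ∀ {A : Set} {k f x} (Q : ℕ → A → Set) → (∀ {i} → i ℕ.< k → Q i (f i)) → Q k x →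
            ∀ {i} → i ℕ.< suc k → Q i (snoc k f x i)
snoc-elim {k = k} {x = x} Q below at {i} i<1+k with i ℕ.<? k
... | yes i<k = below i<k
... | no  i≮k = subst (λ j → Q j x) (ℕₚ.≤-antisym (ℕₚ.≮⇒≥ i≮k) (ℕₚ.≤-pred i<1+k)) at

separated⇒injective : ∀ {A : Set} {k} {f : ℕ → A} → (∀ {i j} → i ℕ.< j → j ℕ.< k → f i ≢ f j) →
                      ∀ (i j : Fin k) → f (toℕ i) ≡ f (toℕ j) → i ≡ j
separated⇒injective sep i j fi≡fj with ℕₚ.<-cmp (toℕ i) (toℕ j)
... | tri< i<j _ _ = ⊥-elim (sep i<j (Finₚ.toℕ<n j) fi≡fj)
... | tri≈ _ i≡j _ = Finₚ.toℕ-injective i≡j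
... | tri> _ _ j<i = ⊥-elim (sep j<i (Finₚ.toℕ<n i) (sym fi≡fj))

ladderHeight : ℕ → ℕ
ladderHeight zero    = 0
ladderHeight (suc k) = 4 + (ladderHeight k + ladderHeight k)

4+ladderHeight≡2^[k+2] : ∀ k → 4 + ladderHeight k ≡ 2 ^ (k + 2)
4+ladderHeight≡2^[k+2] zero    = refl
4+ladderHeight≡2^[k+2] (suc k) = begin
  4 + (4 + (h + h))          ≡⟨ regroup h ⟩
  (4 + h) + ((4 + h) + 0)    ≡⟨ cong (λ z → z + (z + 0)) (4+ladderHeight≡2^[k+2] k) ⟩
  2 ^ (suc k + 2)            ∎
  where
  open ≡-Reasoning
  h = ladderHeight k
  regroup : ∀ h → 4 + (4 + (h + h)) ≡ (4 + h) + ((4 + h) + 0)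
  regroup = solve-∀

ladderHeight≤treeBound∸1 : ∀ k → ladderHeight k ℕ.≤ treeBound k ∸ 1
ladderHeight≤treeBound∸1 k =
  subst (λ z → ladderHeight k ℕ.≤ z ∸ 2 ∸ 1) (4+ladderHeight≡2^[k+2] k) (ℕₚ.n≤1+n (ladderHeight k))

module _ {n : ℕ} (G : Graph n) where

  private variable
    P Q X Y : Fin n → Set

  edge⇒≢ : ∀ {x y} → E G x y ≡ true → x ≢ y
  edge⇒≢ {x} xy refl = not-¬ (irrefl G x) xy

  -- A half graph of size k: R(a i, b j) iff i < j.  The sequences are indexed by ℕ
  -- (only i, j < k matter) so that a pair can be added at either end.
  record Ladder (k : ℕ) (P X : Fin n → Set) : Set where
    field
      a b  : ℕ → Fin n
      a∈X  : ∀ {i} → i ℕ.< k → X (a i)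
      b∈P  : ∀ {j} → j ℕ.< k → P (b j)
      edge : ∀ {i j} → i ℕ.< k → j ℕ.< k → E G (a i) (b j) ≡ (i <ᵇ j)
      a≢b  : ∀ {i j} → i ℕ.< k → j ℕ.< k → a i ≢ b j

  Ladder-map : ∀ {k} → (∀ {b} → P b → Q b) → (∀ {x} → X x → Y x) → Ladder k P X → Ladder k Q Y
  Ladder-map f g L = record
    { a = a ; b = b ; a∈X = g ∘ a∈X ; b∈P = f ∘ b∈P ; edge = edge ; a≢b = a≢b }
    where open Ladder L

  ladder-cons : ∀ {k P X a₀ b₀} → X a₀ → P b₀ → E G a₀ b₀ ≡ false → a₀ ≢ b₀ →
                Ladder k (λ b → P b × E G a₀ b ≡ true) (λ a → X a × E G a b₀ ≡ false × a ≢ b₀) →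
                Ladder (suc k) P X
  ladder-cons {k} {P} {X} {a₀} {b₀} a₀∈X b₀∈P a₀b₀ a₀≢b₀ L = record
    { a = a₀ ◂ a ; b = b₀ ◂ b ; a∈X = a∈X′ ; b∈P = b∈P′ ; edge = edge′ ; a≢b = a≢b′ }
    where
    open Ladder L
    a∈X′ : ∀ {i} → i ℕ.< suc k → X ((a₀ ◂ a) i)
    a∈X′ {zero}  _         = a₀∈X
    a∈X′ {suc i} (s≤s i<k) = proj₁ (a∈X i<k)
    b∈P′ : ∀ {j} → j ℕ.< suc k → P ((b₀ ◂ b) j)
    b∈P′ {zero}  _         = b₀∈P
    b∈P′ {suc j} (s≤s j<k) = proj₁ (b∈P j<k)
    edge′ : ∀ {i j} → i ℕ.< suc k → j ℕ.< suc k → E G ((a₀ ◂ a) i) ((b₀ ◂ b) j) ≡ (i <ᵇ j)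
    edge′ {zero}  {zero}  _         _         = a₀b₀
    edge′ {zero}  {suc j} _         (s≤s j<k) = proj₂ (b∈P j<k)
    edge′ {suc i} {zero}  (s≤s i<k) _         = proj₁ (proj₂ (a∈X i<k))
    edge′ {suc i} {suc j} (s≤s i<k) (s≤s j<k) = edge i<k j<k
    a≢b′ : ∀ {i j} → i ℕ.< suc k → j ℕ.< suc k → (a₀ ◂ a) i ≢ (b₀ ◂ b) j
    a≢b′ {zero}  {zero}  _         _         = a₀≢b₀
    a≢b′ {zero}  {suc j} _         (s≤s j<k) = edge⇒≢ (proj₂ (b∈P j<k))
    a≢b′ {suc i} {zero}  (s≤s i<k) _         = proj₂ (proj₂ (a∈X i<k))
    a≢b′ {suc i} {suc j} (s≤s i<k) (s≤s j<k) = a≢b i<k j<k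

  ladder-snoc : ∀ {k P X a₀ b₀} → X a₀ → P b₀ → E G a₀ b₀ ≡ false → a₀ ≢ b₀ →
                Ladder k (λ b → P b × E G a₀ b ≡ false × b ≢ a₀) (λ a → X a × E G a b₀ ≡ true) →
                Ladder (suc k) P X
  ladder-snoc {k} {P} {X} {a₀} {b₀} a₀∈X b₀∈P a₀b₀ a₀≢b₀ L = record
    { a = a′ ; b = b′
    ; a∈X = snoc-elim (λ _ x → X x) (proj₁ ∘ a∈X) a₀∈X
    ; b∈P = snoc-elim (λ _ y → P y) (proj₁ ∘ b∈P) b₀∈P
    ; edge = edge′ ; a≢b = a≢b′ }
    where
    open Ladder L
    a′ b′ : ℕ → Fin n
    a′ = snoc k a a₀
    b′ = snoc k b b₀
    edge′ : ∀ {i j} → i ℕ.< suc k → j ℕ.< suc k → E G (a′ i) (b′ j) ≡ (i <ᵇ j)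
    edge′ {i} {j} i<1+k j<1+k = snoc-elim (λ i x → E G x (b′ j) ≡ (i <ᵇ j)) old-a new-a i<1+k
      where
      old-a : ∀ {i} → i ℕ.< k → E G (a i) (b′ j) ≡ (i <ᵇ j)
      old-a i<k = snoc-elim (λ j y → E G (a _) y ≡ (_ <ᵇ j)) (edge i<k)
                    (trans (proj₂ (a∈X i<k)) (sym (<ᵇ-true i<k))) j<1+k
      new-a : E G a₀ (b′ j) ≡ (k <ᵇ j)
      new-a = snoc-elim (λ j y → E G a₀ y ≡ (k <ᵇ j))
                (λ j<k → trans (proj₁ (proj₂ (b∈P j<k))) (sym (<ᵇ-false (ℕₚ.<⇒≤ j<k))))
                (trans a₀b₀ (sym (<ᵇ-false (ℕₚ.≤-refl {k})))) j<1+k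
    a≢b′ : ∀ {i j} → i ℕ.< suc k → j ℕ.< suc k → a′ i ≢ b′ j
    a≢b′ {i} {j} i<1+k j<1+k = snoc-elim (λ _ x → x ≢ b′ j) old-a new-a i<1+k
      where
      old-a : ∀ {i} → i ℕ.< k → a i ≢ b′ j
      old-a i<k = snoc-elim (λ _ y → a _ ≢ y) (a≢b i<k) (edge⇒≢ (proj₂ (a∈X i<k))) j<1+k
      new-a : a₀ ≢ b′ j
      new-a = snoc-elim (λ _ y → a₀ ≢ y) (λ j<k → proj₂ (proj₂ (b∈P j<k)) ∘ sym) a₀≢b₀ j<1+k

  -- r is the root and s its 0-child.  A leaf a of the 00-subtree avoiding r and s is
  -- adjacent to neither.  The leaves of the 01-subtree other than r span a tree whose
  -- internal vertices avoid a; split by adjacency to a, a half graph inside the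
  -- adjacent part extends by (a, r) at the front, one inside the other part by (a, s)
  -- at the end.
  tree⇒ladder : ∀ k {P X} → Tree G P X (ladderHeight k) → Ladder k P X
  tree⇒ladder zero t = record
    { a = λ _ → x ; b = λ _ → x ; a∈X = λ () ; b∈P = λ () ; edge = λ () ; a≢b = λ () }
    where x = proj₁ (someLeaf G t)
  tree⇒ladder (suc k) {P} {X} (node r r∈P tʳ) with tʳ false
  ... | node s s∈P tˢ = from-leaf (someLeaf G (Tree-avoidLeaf G s (Tree-avoidLeaf G r (tˢ false))))
    where
    h = ladderHeight k
    from-leaf : Σ (Fin n) (λ a → (((X a × E G a r ≡ false) × E G a s ≡ false) × a ≢ r) × a ≢ s) →
                Ladder (suc k) P X
    from-leaf (a , ((((a∈X , ar) , as) , a≢r) , a≢s)) =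
      [ ladder-cons a∈X r∈P ar a≢r ∘ Ladder-map (λ ((b∈P , _) , ab) → b∈P , ab)
                                                (λ (((x∈X , xr) , _) , x≢r) → x∈X , xr , x≢r)
                                   ∘ tree⇒ladder k
      , ladder-snoc a∈X s∈P as a≢s ∘ Ladder-map (λ ((b∈P , b≢a) , ab) → b∈P , ab , b≢a)
                                                (λ (((x∈X , _) , xs) , _) → x∈X , xs)
                                   ∘ tree⇒ladder k
      ]′ (Tree-ramsey G (E G a) h h (Tree-avoidNode G a (Tree-avoidLeaf G r (tˢ true))))

  module _ {k P X} (L : Ladder k P X) where
    open Ladder L

    a-separated : ∀ {i j} → i ℕ.< j → j ℕ.< k → a i ≢ a j
    a-separated {i} {j} i<j j<k ai≡aj = not-¬ (trans (edge (ℕₚ.<-trans i<j j<k) j<k) (<ᵇ-true i<j))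
      (trans (cong (λ x → E G x (b j)) ai≡aj) (trans (edge j<k j<k) (<ᵇ-false (ℕₚ.≤-refl {j}))))

    b-separated : ∀ {i j} → i ℕ.< j → j ℕ.< k → b i ≢ b j
    b-separated {i} {j} i<j j<k bi≡bj = not-¬ (trans (edge i<k j<k) (<ᵇ-true i<j))
      (trans (cong (E G (a i)) (sym bi≡bj)) (trans (edge i<k i<k) (<ᵇ-false (ℕₚ.≤-refl {i}))))
      where i<k = ℕₚ.<-trans i<j j<k

  EdgeStable⇒¬Ladder : ∀ {k P X} → EdgeStable k G → ¬ Ladder k P X
  EdgeStable⇒¬Ladder {k} stable L = stable
    ( a ∘ toℕ , b ∘ toℕ
    , separated⇒injective (a-separated L) , separated⇒injective (b-separated L)
    , (λ i j → a≢b (Finₚ.toℕ<n i) (Finₚ.toℕ<n j))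
    , λ i j → mk⇔ (λ e → ℕₚ.<ᵇ⇒< (toℕ i) (toℕ j) (Equivalence.from T-≡ (trans (sym (edge′ i j)) e)))
                  (λ i<j → trans (edge′ i j) (<ᵇ-true i<j)) )
    where
    open Ladder L
    edge′ : ∀ (i j : Fin k) → E G (a (toℕ i)) (b (toℕ j)) ≡ (toℕ i <ᵇ toℕ j)
    edge′ i j = edge (Finₚ.toℕ<n i) (Finₚ.toℕ<n j)

-- Excellent subsets

invert-does : ∀ {A : Set} (a? : Dec A) {b} → does a? ≡ b → if b then A else ¬ A
invert-does a? refl = invert (proof a?)

misfits : ∀ {n} → Graph n → Fin n → Bool → Subset n → Subset n
misfits G x true  B = nonNbrs G x B
misfits G x false B = nbrs G x B

∉misfits⇒edge : ∀ {n} (G : Graph n) {B x b} ℓ → b ∈ B → b ∉ misfits G x ℓ B → E G x b ≡ ℓ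
∉misfits⇒edge G true  b∈B b∉ = not-injective (x∈p∧x∉p∩tabulate⇒false b∈B b∉)
∉misfits⇒edge G false b∈B b∉ = x∈p∧x∉p∩tabulate⇒false b∈B b∉

module _ {n : ℕ} (G : Graph n) (ε : ℚ) where

  ∈withT⁻ : ∀ {B Y x} ℓ → x ∈ withT G ε B ℓ Y → x ∈ Y × tv G ε x B ≡ ℓ
  ∈withT⁻ true  x∈ = Product.map₂ x∈tabulate⁻ (x∈p∩q⁻ _ _ x∈)
  ∈withT⁻ false x∈ = Product.map₂ (not-injective ∘ x∈tabulate⁻) (x∈p∩q⁻ _ _ x∈)

  small? : ∀ (S A : Subset n) → Dec (Small ε S A)
  small? S A = ℕ→ℚ ∣ S ∣ <? ε * ℕ→ℚ ∣ A ∣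

  good? : ∀ B → Dec (Good G ε B)
  good? B = Finₚ.all? {P = λ b → Small ε (nbrs G b B) B ⊎ Small ε (nonNbrs G b B) B}
                      λ b → small? (nbrs G b B) B ⊎-dec small? (nonNbrs G b B) B

  misfits-small : ∀ {B x} ℓ → Good G ε B → tv G ε x B ≡ ℓ → Small ε (misfits G x ℓ B) B
  misfits-small {B} {x} true  _      tv≡true  =
    invert-does (small? (nonNbrs G x B) B) tv≡true
  misfits-small {B} {x} false B-good tv≡false =
    [ id , ⊥-elim ∘ invert-does (small? (nonNbrs G x B) B) tv≡false ]′ (B-good x)

  Splits : Subset n → Subset n → Set
  Splits Y B = Good G ε B × ¬ Small ε (withT G ε B true Y) Y × ¬ Small ε (withT G ε B false Y) Y

  excellent-or-splits : ∀ Y → Excellent G ε Y ⊎ ∃ (Splits Y)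
  excellent-or-splits Y = from-dec (anySubset? {P = Splits Y} splits?)
    where
    splits? : ∀ B → Dec (Splits Y B)
    splits? B = good? B ×-dec ¬? (small? (withT G ε B true Y) Y)
                        ×-dec ¬? (small? (withT G ε B false Y) Y)

    one-small : ∀ {B} → ¬ Splits Y B → Good G ε B →
                Dec (Small ε (withT G ε B true Y) Y) → Dec (Small ε (withT G ε B false Y) Y) →
                Small ε (withT G ε B true Y) Y ⊎ Small ε (withT G ε B false Y) Y
    one-small _        _      (yes small₁) _            = inj₁ small₁
    one-small _        _      (no _)       (yes small₀) = inj₂ small₀
    one-small ¬splits B-good (no large₁)  (no large₀)  =
      ⊥-elim (¬splits (B-good , large₁ , large₀))

    from-dec : Dec (∃ (Splits Y)) → Excellent G ε Y ⊎ ∃ (Splits Y)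
    from-dec (yes splitter)  = inj₂ splitter
    from-dec (no ¬splitter) = inj₁ λ B B-good →
      one-small {B} (¬splitter ∘ (B ,_)) B-good
                (small? (withT G ε B true Y) Y) (small? (withT G ε B false Y) Y)

  ExcellentSubset : ℚ → Subset n → Set
  ExcellentSubset δ Y =
    Σ (Subset n) λ Y′ → Y′ ⊆ Y × Excellent G ε Y′ × δ * ℕ→ℚ ∣ Y ∣ ≤ ℕ→ℚ ∣ Y′ ∣

  graft : ∀ {m Y} B → Good G ε B → ℕ→ℚ (2 ^ suc m) * ε ≤ 1ℚ →
          ((ℓ : Bool) → Tree G U (_∈ withT G ε B ℓ Y) m) → Tree G U (_∈ Y) (suc m)
  graft {m} {Y} B B-good 2ᵐ⁺¹ε≤1 t = node b _ child
    where
    misfitsOf : Bool → List (Subset n)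
    misfitsOf ℓ = map (λ x → misfits G x ℓ B) (leaves G (t ℓ))

    length-misfitsOf : ∀ ℓ → length (misfitsOf ℓ) ≡ 2 ^ m
    length-misfitsOf ℓ = trans (length-map _ (leaves G (t ℓ))) (length-leaves G (t ℓ))

    length-misfits : length (misfitsOf true ++ misfitsOf false) ≡ 2 ^ suc m
    length-misfits = begin
      length (misfitsOf true ++ misfitsOf false)
        ≡⟨ length-++ (misfitsOf true) ⟩
      length (misfitsOf true) + length (misfitsOf false)
        ≡⟨ cong₂ _+_ (length-misfitsOf true) (length-misfitsOf false) ⟩
      2 ^ m + 2 ^ m
        ≡⟨ 2^m+2^m≡2^[1+m] m ⟩
      2 ^ suc m ∎
      where open ≡-Reasoning

    misfits-small-all : ∀ ℓ → All (λ S → Small ε S B) (misfitsOf ℓ)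
    misfits-small-all ℓ =
      All.map⁺ (All.map (misfits-small ℓ B-good ∘ proj₂ ∘ ∈withT⁻ ℓ) (All-leaves G (t ℓ)))

    enough : ℕ→ℚ (length (misfitsOf true ++ misfitsOf false)) * (ε * ℕ→ℚ ∣ B ∣) ≤ ℕ→ℚ ∣ B ∣
    enough = begin
      ℕ→ℚ (length (misfitsOf true ++ misfitsOf false)) * (ε * ℕ→ℚ ∣ B ∣)
        ≡⟨ cong (λ k → ℕ→ℚ k * (ε * ℕ→ℚ ∣ B ∣)) length-misfits ⟩
      ℕ→ℚ (2 ^ suc m) * (ε * ℕ→ℚ ∣ B ∣)
        ≡⟨ sym (*-assoc (ℕ→ℚ (2 ^ suc m)) ε (ℕ→ℚ ∣ B ∣)) ⟩
      ℕ→ℚ (2 ^ suc m) * ε * ℕ→ℚ ∣ B ∣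
        ≤⟨ *-monoʳ-≤-nonNeg (ℕ→ℚ ∣ B ∣) {{nonNegative (ℕ→ℚ-nonNeg ∣ B ∣)}} 2ᵐ⁺¹ε≤1 ⟩
      1ℚ * ℕ→ℚ ∣ B ∣
        ≡⟨ *-identityˡ (ℕ→ℚ ∣ B ∣) ⟩
      ℕ→ℚ ∣ B ∣ ∎
      where open ≤-Reasoning

    chosen : ∃ λ b → b ∈ B × All (b ∉_) (misfitsOf true ++ misfitsOf false)
    chosen = avoid-small-sets B (misfitsOf true ++ misfitsOf false)
               (subst (0 ℕ.<_) (sym length-misfits) (ℕₚ.m^n>0 2 (suc m)))
               (All.++⁺ (misfits-small-all true) (misfits-small-all false)) enough

    b = proj₁ chosen

    child : (ℓ : Bool) → Tree G U (λ x → x ∈ Y × E G x b ≡ ℓ) m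
    child ℓ = Tree-map G id (Product.map₁ (proj₁ ∘ ∈withT⁻ ℓ))
      (Tree-restrict G (t ℓ) (All.map (∉misfits⇒edge G ℓ (proj₁ (proj₂ chosen)))
                                      (All.map⁻ (All-++-select misfitsOf ℓ (proj₂ (proj₂ chosen))))))

module _ {n : ℕ} (G : Graph n) {ε : ℚ} (0≤ε : 0ℚ ≤ ε) (ε≤1 : ε ≤ 1ℚ) where

  excellent-or-tree : ∀ m (Y : Subset n) → 1ℚ ≤ ε ^ℚ m * ℕ→ℚ ∣ Y ∣ → ℕ→ℚ (2 ^ m) * ε ≤ 1ℚ →
                      ExcellentSubset G ε (ε ^ℚ m) Y ⊎ Tree G U (_∈ Y) m
  excellent-or-tree zero Y 1≤∣Y∣ _ = inj₂ (leaf (proj₁ x∈Y) (proj₁ (proj₂ x∈Y)))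
    where
    0<∣Y∣ : 0 ℕ.< ∣ Y ∣
    0<∣Y∣ = ℕ→ℚ-cancel-<
      (<-≤-trans (from-yes (0ℚ <? 1ℚ)) (≤-trans 1≤∣Y∣ (≤-reflexive (*-identityˡ (ℕ→ℚ ∣ Y ∣)))))
    x∈Y = ∣p∣<∣q∣⇒∃x∈q∖p ⊥ Y (subst (ℕ._< ∣ Y ∣) (sym (∣⊥∣≡0 n)) 0<∣Y∣)
  excellent-or-tree (suc m) Y 1≤εᵐ⁺¹∣Y∣ 2ᵐ⁺¹ε≤1 =
    [ inj₁ ∘ whole , split ]′ (excellent-or-splits G ε Y)
    where
    whole : Excellent G ε Y → ExcellentSubset G ε (ε ^ℚ suc m) Y
    whole Y-excellent = Y , id , Y-excellent ,
      ≤-trans (*-monoʳ-≤-nonNeg (ℕ→ℚ ∣ Y ∣) {{nonNegative (ℕ→ℚ-nonNeg ∣ Y ∣)}}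
                (^ℚ-antitone 0≤ε ε≤1 {0} {suc m} z≤n))
              (≤-reflexive (*-identityˡ (ℕ→ℚ ∣ Y ∣)))

    2ᵐε≤1 : ℕ→ℚ (2 ^ m) * ε ≤ 1ℚ
    2ᵐε≤1 = ≤-trans (*-monoʳ-≤-nonNeg ε {{nonNegative 0≤ε}}
                      (ℕ→ℚ-mono-≤ (ℕₚ.^-monoʳ-≤ 2 (ℕₚ.n≤1+n m))))
                    2ᵐ⁺¹ε≤1

    split : ∃ (Splits G ε Y) → ExcellentSubset G ε (ε ^ℚ suc m) Y ⊎ Tree G U (_∈ Y) (suc m)
    split (B , B-good , ¬small₁ , ¬small₀) =
      Sum.map₂ (graft G ε {m} {Y} B B-good 2ᵐ⁺¹ε≤1) (⊎-Π recurse)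
      where
      Y[_] : Bool → Subset n
      Y[ ℓ ] = withT G ε B ℓ Y

      shrink : ∀ ℓ {z} → ε ^ℚ m * ℕ→ℚ ∣ Y[ ℓ ] ∣ ≤ z → ε ^ℚ suc m * ℕ→ℚ ∣ Y ∣ ≤ z
      shrink true  = ≤-trans (^ℚ-suc-*-≤ {ε} {ℕ→ℚ ∣ Y ∣} {ℕ→ℚ ∣ Y[ true ] ∣} m 0≤ε (≮⇒≥ ¬small₁))
      shrink false = ≤-trans (^ℚ-suc-*-≤ {ε} {ℕ→ℚ ∣ Y ∣} {ℕ→ℚ ∣ Y[ false ] ∣} m 0≤ε (≮⇒≥ ¬small₀))

      lift : ∀ ℓ → ExcellentSubset G ε (ε ^ℚ m) Y[ ℓ ] → ExcellentSubset G ε (ε ^ℚ suc m) Y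
      lift ℓ (Y′ , Y′⊆Yℓ , Y′-excellent , large) =
        Y′ , proj₁ ∘ ∈withT⁻ G ε {B} {Y} ℓ ∘ Y′⊆Yℓ , Y′-excellent , shrink ℓ large

      recurse : ∀ ℓ → ExcellentSubset G ε (ε ^ℚ suc m) Y ⊎ Tree G U (_∈ Y[ ℓ ]) m
      recurse ℓ = Sum.map₁ (lift ℓ)
        (excellent-or-tree m Y[ ℓ ] (≤-trans 1≤εᵐ⁺¹∣Y∣ (shrink ℓ ≤-refl)) 2ᵐε≤1)

claim1p8 : (k : ℕ) → 1 Data.Nat.≤ k →
    (n : ℕ) (G : Graph n) → EdgeStable k G →
    (ε : ℚ) → 0ℚ < ε → ε < ½ ^ℚ treeBound k →
    (A : Subset n) → 1ℚ ≤ (ε ^ℚ treeBound k) * ℕ→ℚ ∣ A ∣ →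
    Σ (Subset n) λ A′ → A′ ⊆ A × Excellent G ε A′ ×
      (ε ^ℚ (treeBound k ∸ 1)) * ℕ→ℚ ∣ A ∣ ≤ ℕ→ℚ ∣ A′ ∣
claim1p8 k _ n G stable ε 0<ε ε<½ᵗ A 1≤εᵗ∣A∣ =
  [ id , (λ tree → ⊥-elim (EdgeStable⇒¬Ladder G stable
                            (tree⇒ladder G k (Tree-lower G (ladderHeight≤treeBound∸1 k) tree)))) ]′
    (excellent-or-tree G 0≤ε ε≤1 (t ∸ 1) A 1≤εᵗ⁻¹∣A∣ (2^m*ε≤1 (t ∸ 1) 0≤ε ε≤½ᵗ⁻¹))
  where
  t = treeBound k
  0≤ε = <⇒≤ 0<ε
  ½^-antitone : ∀ {i j} → i ℕ.≤ j → ½ ^ℚ j ≤ ½ ^ℚ i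
  ½^-antitone = ^ℚ-antitone (from-yes (0ℚ ≤? ½)) (from-yes (½ ≤? 1ℚ))
  ε≤½ᵗ⁻¹ : ε ≤ ½ ^ℚ (t ∸ 1)
  ε≤½ᵗ⁻¹ = ≤-trans (<⇒≤ ε<½ᵗ) (½^-antitone (ℕₚ.m∸n≤m t 1))
  ε≤1 : ε ≤ 1ℚ
  ε≤1 = ≤-trans ε≤½ᵗ⁻¹ (½^-antitone {0} {t ∸ 1} z≤n)
  1≤εᵗ⁻¹∣A∣ : 1ℚ ≤ ε ^ℚ (t ∸ 1) * ℕ→ℚ ∣ A ∣
  1≤εᵗ⁻¹∣A∣ = ≤-trans 1≤εᵗ∣A∣ (*-monoʳ-≤-nonNeg (ℕ→ℚ ∣ A ∣) {{nonNegative (ℕ→ℚ-nonNeg ∣ A ∣)}}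
                                  (^ℚ-antitone 0≤ε ε≤1 (ℕₚ.m∸n≤m t 1)))
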